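{- For any integer $n\ge 2$ with $n\ne 3$, there exists a connected graph $G$ such that $G_{SR}\cong P_n$.
   Context: All graphs are finite, simple and undirected; $d_G$ is the distance in $G$. A vertex $u$ is maximally distant from $v$ if $d_G(v,w)\le d_G(u,v)$ for every neighbor $w$ of $u$. Vertices $u,v$ are mutually maximally distant (MMD) if each is maximally distant from the other. The boundary $\partial(G)$ is the set of vertices maximally distant from some vertex of $G$. The strong resolving graph $G_{SR}$ (defined for connected $G$) has vertex set $\partial(G)$, two vertices being adjacent iff they are MMD in $G$. $P_n$ is the path on $n$ vertices. -}

module Defs where

open import Level using (0ℓ)
open import Data.Nat using (ℕ; zero; suc; _≤_; _+_)
open import Data.Fin using (Fin; toℕ)
open import Data.Product using (Σ; ∃; _×_)
open import Data.Sum using (_⊎_)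
open import Relation.Nullary using (¬_; Dec)
open import Relation.Binary.PropositionalEquality using (_≡_)

record Graph : Set₁ where
  field
    V     : ℕ
    Adj   : Fin V → Fin V → Set
    adj?  : ∀ u v → Dec (Adj u v)
    sym   : ∀ {u v} → Adj u v → Adj v u
    irrefl : ∀ {u} → ¬ Adj u u

module _ (G : Graph) where
  open Graph G

  data Walk : Fin V → Fin V → ℕ → Set where
    here : ∀ {u} → Walk u u zero
    step : ∀ {u w v k} → Adj u w → Walk w v k → Walk u v (suc k)

  Dist : Fin V → Fin V → ℕ → Set
  Dist u v k = Walk u v k × (∀ j → Walk u v j → k ≤ j)

  Connected : Set
  Connected = ∀ u v → ∃ λ k → Walk u v k

  MaxDist : Fin V → Fin V → Set
  MaxDist u v = ∀ w → Adj u w → ∀ a b → Dist v w a → Dist u v b → a ≤ b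

  MMD : Fin V → Fin V → Set
  MMD u v = MaxDist u v × MaxDist v u

  Boundary : Fin V → Set
  Boundary u = ∃ λ v → MaxDist u v

  -- adjacency in G_SR (a simple graph, so distinct vertices)
  SRAdj : Fin V → Fin V → Set
  SRAdj u v = ¬ (u ≡ v) × MMD u v

PathAdj : ∀ {n} → Fin n → Fin n → Set
PathAdj i j = (suc (toℕ i) ≡ toℕ j) ⊎ (suc (toℕ j) ≡ toℕ i)

-- G_SR ≅ P_n : a bijection f from Fin n onto ∂(G) preserving and reflecting adjacency.
SRIsoPath : Graph → ℕ → Set
SRIsoPath G n =
  Σ (Fin n → Fin (Graph.V G)) λ f →
    (∀ i j → f i ≡ f j → i ≡ j) ×
    (∀ i → Boundary G (f i)) ×
    (∀ u → Boundary G u → ∃ λ i → f i ≡ u) ×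
    (∀ i j → (SRAdj G (f i) (f j) → PathAdj i j) × (PathAdj i j → SRAdj G (f i) (f j)))

-- Take G = K₁ + co-P_n: the complement of P_n with an apex joined to every vertex.
-- The apex gives G diameter at most 2, so two path-consecutive vertices, being
-- non-adjacent in G, are MMD. Two adjacent vertices u, v are not MMD as soon as u has a
-- neighbour not adjacent to v; the apex always has one, and for n ≠ 3 so does one of any
-- two non-consecutive path vertices (for n = 3 the ends of P_3 are twins in G).
module Submission where

open import Defs
open import Data.Nat using (ℕ; _≤_)
open import Data.Product using (Σ; _×_)
open import Relation.Nullary using (¬_)
open import Relation.Binary.PropositionalEquality using (_≡_)

open import Data.Nat using (zero; suc; _<_; z≤n; s≤s; _<?_) renaming (_≟_ to _≟ℕ_)
open import Data.Nat.Properties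
  using (module ≤-Reasoning; ≤-refl; <-irrefl; <-trans; n<1+n; ≤-antisym; ≮⇒≥; suc-injective; <-cmp)
open import Data.Fin using (Fin; toℕ; fromℕ<; inject₁; zero; suc; _≟_)
open import Data.Fin.Properties
  using (toℕ<n; toℕ-injective; toℕ-fromℕ<; toℕ-inject₁) renaming (suc-injective to Fin-suc-injective)
open import Data.Product using (_,_; proj₁; proj₂; ∃)
open import Data.Sum using (_⊎_; inj₁; inj₂; swap)
open import Data.Unit using (⊤; tt)
open import Data.Empty using (⊥; ⊥-elim)
open import Function using (_∘_)
open import Relation.Nullary using (Dec; yes; no)
open import Relation.Nullary.Decidable using (_×-dec_; _⊎-dec_; ¬?)
open import Relation.Binary using (tri<; tri≈; tri>)
open import Relation.Binary.PropositionalEquality using (_≢_; refl; sym; trans; cong; subst)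

module _ (G : Graph) where
  open Graph G using (Adj; irrefl)

  walk-length-0 : ∀ {u v} → Walk G u v 0 → u ≡ v
  walk-length-0 here = refl

  walk-length-1 : ∀ {u v} → Walk G u v 1 → Adj u v
  walk-length-1 (step a here) = a

  dist-refl : ∀ u → Dist G u u 0
  dist-refl u = here , λ _ _ → z≤n

  dist-adj : ∀ {u v} → Adj u v → Dist G u v 1
  dist-adj {u} a = step a here , shortest
    where
    shortest : ∀ j → Walk G u _ j → 1 ≤ j
    shortest zero w = ⊥-elim (irrefl (subst (Adj u) (sym (walk-length-0 w)) a))
    shortest (suc j) w = s≤s z≤n

  walk-length≥2 : ∀ {u v} → u ≢ v → ¬ Adj u v → ∀ j → Walk G u v j → 2 ≤ j
  walk-length≥2 u≢v ¬a zero w = ⊥-elim (u≢v (walk-length-0 w))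
  walk-length≥2 u≢v ¬a (suc zero) w = ⊥-elim (¬a (walk-length-1 w))
  walk-length≥2 u≢v ¬a (suc (suc j)) w = s≤s (s≤s z≤n)

  maxDist-self⇒¬adj : ∀ {u w} → MaxDist G u u → ¬ Adj u w
  maxDist-self⇒¬adj {u} {w} md a with md w a 1 0 (dist-adj a) (dist-refl u)
  ... | ()

  Diameter≤2 : Set
  Diameter≤2 = ∀ u v → ∃ λ k → k ≤ 2 × Walk G u v k

  diameter≤2⇒connected : Diameter≤2 → Connected G
  diameter≤2⇒connected diam u v = proj₁ (diam u v) , proj₂ (proj₂ (diam u v))

  module _ (diam : Diameter≤2) where

    dist-nonadj : ∀ {u v} → u ≢ v → ¬ Adj u v → Dist G u v 2
    dist-nonadj {u} {v} u≢v ¬a with diam u v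
    ... | k , k≤2 , w with ≤-antisym k≤2 (walk-length≥2 u≢v ¬a k w)
    ...   | refl = w , walk-length≥2 u≢v ¬a

    maxDist-nonadj : ∀ {u v} → u ≢ v → ¬ Adj u v → MaxDist G u v
    maxDist-nonadj {v = v} u≢v ¬a w _ a b (_ , v⇝w-shortest) (u⇝v , _) with diam v w
    ... | k , k≤2 , v⇝w = begin
      a ≤⟨ v⇝w-shortest k v⇝w ⟩
      k ≤⟨ k≤2 ⟩
      2 ≤⟨ walk-length≥2 u≢v ¬a b u⇝v ⟩
      b ∎
      where open ≤-Reasoning

    ¬maxDist-private-neighbour : ∀ {u v w} → Adj u v → Adj u w → v ≢ w → ¬ Adj v w → ¬ MaxDist G u v
    ¬maxDist-private-neighbour {w = w} u~v u~w v≢w ¬v~w md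
      with md w u~w 2 1 (dist-nonadj v≢w ¬v~w) (dist-adj u~v)
    ... | s≤s ()

Consecutive : ℕ → ℕ → Set
Consecutive a b = suc a ≡ b ⊎ suc b ≡ a

consecutive? : ∀ a b → Dec (Consecutive a b)
consecutive? a b = (suc a ≟ℕ b) ⊎-dec (suc b ≟ℕ a)

consecutive-sym : ∀ {a b} → Consecutive a b → Consecutive b a
consecutive-sym = swap

consecutive⇒≢ : ∀ {a b} → Consecutive a b → a ≢ b
consecutive⇒≢ (inj₁ e) refl = <-irrefl (sym e) (n<1+n _)
consecutive⇒≢ (inj₂ e) refl = <-irrefl (sym e) (n<1+n _)

-- In coneCoPath n below, c is then adjacent to a but not to b, so a is not maximally distant from b.
Separatorℕ : ℕ → ℕ → ℕ → Set
Separatorℕ n a b = ∃ λ c → c < n × Consecutive b c × c ≢ a × ¬ Consecutive a c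

separatorℕ-< : ∀ {n a b} → n ≢ 3 → a < b → b < n → ¬ Consecutive a b →
               Separatorℕ n a b ⊎ Separatorℕ n b a
separatorℕ-< {n} {a} {b} n≢3 a<b b<n a≁b with suc b <? n
... | yes 1+b<n = inj₁ (suc b , 1+b<n , inj₁ refl , 1+b≢a , a≁1+b)
  where
  a<1+b : a < suc b
  a<1+b = <-trans a<b (n<1+n b)
  1+b≢a : suc b ≢ a
  1+b≢a e = <-irrefl (sym e) a<1+b
  a≁1+b : ¬ Consecutive a (suc b)
  a≁1+b (inj₁ e) = <-irrefl (suc-injective e) a<b
  a≁1+b (inj₂ e) = <-irrefl (sym e) (<-trans a<1+b (n<1+n _))
separatorℕ-< {a = suc a} {b} n≢3 1+a<b b<n a≁b | no _ =
  inj₂ (a , <-trans a<b b<n , inj₂ refl , a≢b , b≁a)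
  where
  a<b : a < b
  a<b = <-trans (n<1+n a) 1+a<b
  a≢b : a ≢ b
  a≢b e = <-irrefl e a<b
  b≁a : ¬ Consecutive b a
  b≁a (inj₁ e) = <-irrefl (sym e) (<-trans a<b (n<1+n b))
  b≁a (inj₂ e) = <-irrefl e 1+a<b
separatorℕ-< {a = zero} {suc zero} n≢3 a<b b<n a≁b | no _ = ⊥-elim (a≁b (inj₁ refl))
separatorℕ-< {a = zero} {suc (suc b)} n≢3 a<b b<n a≁b | no 1+b≮n =
  inj₁ (suc b , <-trans (n<1+n _) b<n , inj₂ refl , (λ ()) , 0≁1+b)
  where
  -- Here suc (suc b) is the last vertex of P_n, so suc b ≡ 1 would force n ≡ 3.
  0≁1+b : ¬ Consecutive zero (suc b)
  0≁1+b (inj₁ e) rewrite sym (suc-injective e) = n≢3 (≤-antisym (≮⇒≥ 1+b≮n) b<n)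

separatorℕ : ∀ {n a b} → n ≢ 3 → a < n → b < n → a ≢ b → ¬ Consecutive a b →
             Separatorℕ n a b ⊎ Separatorℕ n b a
separatorℕ {a = a} {b} n≢3 a<n b<n a≢b a≁b with <-cmp a b
... | tri< a<b _ _ = separatorℕ-< n≢3 a<b b<n a≁b
... | tri≈ _ a≡b _ = ⊥-elim (a≢b a≡b)
... | tri> _ _ b<a = swap (separatorℕ-< n≢3 b<a a<n (a≁b ∘ consecutive-sym))

Separator : ∀ {n} → Fin n → Fin n → Set
Separator i j = ∃ λ k → PathAdj j k × k ≢ i × ¬ PathAdj i k

separator-fromℕ : ∀ {n} {i j : Fin n} → Separatorℕ n (toℕ i) (toℕ j) → Separator i j
separator-fromℕ {i = i} {j} (c , c<n , j~c , c≢i , i≁c) =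
  fromℕ< c<n , subst (Consecutive (toℕ j)) (sym k≡c) j~c ,
  (λ e → c≢i (trans (sym k≡c) (cong toℕ e))) , (λ i~k → i≁c (subst (Consecutive (toℕ i)) k≡c i~k))
  where
  k≡c : toℕ (fromℕ< c<n) ≡ c
  k≡c = toℕ-fromℕ< c<n

separator : ∀ {n} {i j : Fin n} → n ≢ 3 → i ≢ j → ¬ PathAdj i j → Separator i j ⊎ Separator j i
separator {i = i} {j} n≢3 i≢j i≁j
  with separatorℕ n≢3 (toℕ<n i) (toℕ<n j) (i≢j ∘ toℕ-injective) i≁j
... | inj₁ s = inj₁ (separator-fromℕ s)
... | inj₂ s = inj₂ (separator-fromℕ s)

pathNeighbour : ∀ {n} → 2 ≤ n → (i : Fin n) → ∃ λ j → PathAdj i j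
pathNeighbour {suc zero} (s≤s ()) zero
pathNeighbour {suc (suc n)} _ zero = suc zero , inj₁ refl
pathNeighbour {suc (suc n)} _ (suc i) = inject₁ i , inj₂ (cong suc (toℕ-inject₁ i))

-- The apex is vertex zero and vertex suc i is vertex i of the complement of P_n.
ConeCoPathAdj : ∀ {n} → Fin (suc n) → Fin (suc n) → Set
ConeCoPathAdj zero    zero    = ⊥
ConeCoPathAdj zero    (suc _) = ⊤
ConeCoPathAdj (suc _) zero    = ⊤
ConeCoPathAdj (suc i) (suc j) = i ≢ j × ¬ PathAdj i j

coneCoPath : ℕ → Graph
coneCoPath n = record
  { V      = suc n
  ; Adj    = ConeCoPathAdj
  ; adj?   = adj?
  ; sym    = λ {u} {v} → adj-sym {u} {v}
  ; irrefl = λ {u} → adj-irrefl {u}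
  }
  where
  adj? : (u v : Fin (suc n)) → Dec (ConeCoPathAdj u v)
  adj? zero    zero    = no λ ()
  adj? zero    (suc _) = yes tt
  adj? (suc _) zero    = yes tt
  adj? (suc i) (suc j) = ¬? (i ≟ j) ×-dec ¬? (consecutive? (toℕ i) (toℕ j))

  adj-sym : ∀ {u v : Fin (suc n)} → ConeCoPathAdj u v → ConeCoPathAdj v u
  adj-sym {zero}  {suc _} _ = tt
  adj-sym {suc _} {zero}  _ = tt
  adj-sym {suc _} {suc _} (i≢j , i≁j) = i≢j ∘ sym , i≁j ∘ consecutive-sym

  adj-irrefl : ∀ {u : Fin (suc n)} → ¬ ConeCoPathAdj u u
  adj-irrefl {suc _} (i≢i , _) = i≢i refl

module _ {n : ℕ} where

  coneCoPath-diameter≤2 : Diameter≤2 (coneCoPath n)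
  coneCoPath-diameter≤2 zero    zero    = 0 , z≤n , here
  coneCoPath-diameter≤2 zero    (suc _) = 1 , s≤s z≤n , step tt here
  coneCoPath-diameter≤2 (suc _) zero    = 1 , s≤s z≤n , step tt here
  coneCoPath-diameter≤2 (suc _) (suc _) = 2 , ≤-refl , step {w = zero} tt (step tt here)

  pathAdj⇒suc-≢ : {i j : Fin n} → PathAdj i j → suc i ≢ suc j
  pathAdj⇒suc-≢ i~j e = consecutive⇒≢ i~j (cong toℕ (Fin-suc-injective e))

  pathAdj⇒¬adj : {i j : Fin n} → PathAdj i j → ¬ ConeCoPathAdj (suc i) (suc j)
  pathAdj⇒¬adj i~j (_ , i≁j) = i≁j i~j

  pathAdj⇒srAdj : {i j : Fin n} → PathAdj i j → SRAdj (coneCoPath n) (suc i) (suc j)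
  pathAdj⇒srAdj {i} {j} i~j =
    pathAdj⇒suc-≢ i~j ,
    maxDist-nonadj (coneCoPath n) coneCoPath-diameter≤2 (pathAdj⇒suc-≢ i~j) (pathAdj⇒¬adj i~j) ,
    maxDist-nonadj (coneCoPath n) coneCoPath-diameter≤2 (pathAdj⇒suc-≢ j~i) (pathAdj⇒¬adj j~i)
    where
    j~i : PathAdj j i
    j~i = consecutive-sym i~j

  ¬maxDist-separator : {i j : Fin n} → i ≢ j → ¬ PathAdj i j → Separator i j →
                       ¬ MaxDist (coneCoPath n) (suc i) (suc j)
  ¬maxDist-separator i≢j i≁j (k , j~k , k≢i , i≁k) =
    ¬maxDist-private-neighbour (coneCoPath n) coneCoPath-diameter≤2
      (i≢j , i≁j) (k≢i ∘ sym , i≁k) (pathAdj⇒suc-≢ j~k) (pathAdj⇒¬adj j~k)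

  srAdj⇒pathAdj : {i j : Fin n} → n ≢ 3 → SRAdj (coneCoPath n) (suc i) (suc j) → PathAdj i j
  srAdj⇒pathAdj {i} {j} n≢3 (si≢sj , md , md′) with consecutive? (toℕ i) (toℕ j)
  ... | yes i~j = i~j
  ... | no i≁j = ⊥-elim (¬mmd (separator n≢3 i≢j i≁j))
    where
    i≢j : i ≢ j
    i≢j = si≢sj ∘ cong suc
    ¬mmd : Separator i j ⊎ Separator j i → ⊥
    ¬mmd (inj₁ s) = ¬maxDist-separator i≢j i≁j s md
    ¬mmd (inj₂ s) = ¬maxDist-separator (i≢j ∘ sym) (i≁j ∘ consecutive-sym) s md′

  apex-¬maxDist : 2 ≤ n → ∀ v → ¬ MaxDist (coneCoPath n) zero v
  apex-¬maxDist 2≤n zero md =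
    maxDist-self⇒¬adj (coneCoPath n) {w = suc (fromℕ< (<-trans (s≤s z≤n) 2≤n))} md tt
  apex-¬maxDist 2≤n (suc j) with pathNeighbour 2≤n j
  ... | k , j~k = ¬maxDist-private-neighbour (coneCoPath n) coneCoPath-diameter≤2
                    {w = suc k} tt tt (pathAdj⇒suc-≢ j~k) (pathAdj⇒¬adj j~k)

  suc-boundary : 2 ≤ n → ∀ i → Boundary (coneCoPath n) (suc i)
  suc-boundary 2≤n i with pathNeighbour 2≤n i
  ... | j , i~j = suc j , proj₁ (proj₂ (pathAdj⇒srAdj i~j))

  boundary⇒suc : 2 ≤ n → ∀ u → Boundary (coneCoPath n) u → ∃ λ i → suc i ≡ u
  boundary⇒suc 2≤n zero    (v , md) = ⊥-elim (apex-¬maxDist 2≤n v md)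
  boundary⇒suc 2≤n (suc i) _        = i , refl

proposition18 : ∀ (n : ℕ) → 2 ≤ n → ¬ (n ≡ 3) →
    Σ Graph λ G → Connected G × SRIsoPath G n
proposition18 n 2≤n n≢3 =
  coneCoPath n ,
  diameter≤2⇒connected (coneCoPath n) coneCoPath-diameter≤2 ,
  suc , (λ _ _ → Fin-suc-injective) , suc-boundary 2≤n , boundary⇒suc 2≤n ,
  λ i j → srAdj⇒pathAdj n≢3 , pathAdj⇒srAdj
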